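{- Let $G=(V,E)$ be a connected undirected graph that is not a tree, let $C$ be a cycle of $G$, and let $R\subseteq E$ consist of the edges of $C$ together with the edges of a spanning tree of the graph obtained from $G$ by contracting $C$, so that $(V,R)$ is a connected spanning unicyclic subgraph whose unique cycle is $C$. For $w\in V$ let $\mathrm{depth}(w)$ be the distance from $w$ to $C$ in $(V,R)$ (so $\mathrm{depth}(w)=0$ iff $w\in C$). Let $\sigma$ be an orientation of $E$ in which $v$ is the unique sink (vertex with no outgoing arc). Then, restricted to $(V,R)$, there is a vertex $u$ having at least two outgoing arcs in $(V,R)$ such that $\mathrm{depth}(u)<\max\{1,\mathrm{depth}(v)\}$. Moreover, if $\mathrm{depth}(u)=\mathrm{depth}(v)=0$, $u$ can be chosen so that it has two outgoing arcs in $C$. -}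

module Defs where

open import Data.Nat using (ℕ; zero; suc; _+_; _≤_; _<_; _⊔_)
open import Data.Fin using (Fin; zero; suc; inject₁; fromℕ)
open import Data.Bool using (Bool; true; false; if_then_else_)
open import Data.Product using (_×_; _,_; proj₁; proj₂; ∃; ∃-syntax; Σ)
open import Data.Sum using (_⊎_)
open import Data.Unit using (⊤)
open import Relation.Binary.PropositionalEquality using (_≡_; _≢_)

-- A (finite, undirected) graph on vertex set Fin n with m edges;
-- edge e has (unordered) endpoints given by ends e.
Ends : ℕ → ℕ → Set
Ends n m = Fin m → Fin n × Fin n

module _ {n m : ℕ} (ends : Ends n m) where

  Joins : Fin m → Fin n → Fin n → Set
  Joins e x y = (ends e ≡ (x , y)) ⊎ (ends e ≡ (y , x))

  IsSimple : Set
  IsSimple = (∀ e → proj₁ (ends e) ≢ proj₂ (ends e))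
           × (∀ e e' → Joins e (proj₁ (ends e')) (proj₂ (ends e')) → e ≡ e')

  data Walk (P : Fin m → Set) : Fin n → Fin n → ℕ → Set where
    nil  : ∀ {x} → Walk P x x 0
    step : ∀ {x y z k} (e : Fin m) → P e → Joins e x y → Walk P y z k → Walk P x z (suc k)

  Connected : (P : Fin m → Set) → Set
  Connected P = ∀ x y → ∃[ k ] Walk P x y k

  AllE : Fin m → Set
  AllE _ = ⊤

  InR : (Fin m → Bool) → Fin m → Set
  InR R e = R e ≡ true

  -- A cycle of length suc k (≥ 3) : vertices c 0, …, c k
  -- Consecutive pairs of the cycle (including the closing pair (c k, c 0)).
  Consec : ∀ {k} → (Fin (suc k) → Fin n) → Fin n → Fin n → Set
  Consec {k} c x y = (∃[ i ] (x ≡ c (inject₁ i) × y ≡ c (suc i)))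
                   ⊎ (x ≡ c (fromℕ k) × y ≡ c zero)

  IsCycle : ∀ {k} → (Fin (suc k) → Fin n) → Set
  IsCycle {k} c = (2 ≤ k)
                × (∀ i j → c i ≡ c j → i ≡ j)
                × (∀ x y → Consec c x y → ∃[ e ] Joins e x y)

  CEdge : ∀ {k} → (Fin (suc k) → Fin n) → Fin m → Set
  CEdge c e = ∃[ x ] ∃[ y ] (Consec c x y × Joins e x y)

  OnCycle : ∀ {k} → (Fin (suc k) → Fin n) → Fin n → Set
  OnCycle c w = ∃[ i ] (w ≡ c i)

  IsDepth : ∀ {k} → (Fin (suc k) → Fin n) → (Fin m → Bool) → Fin n → ℕ → Set
  IsDepth c R w d = (∃[ i ] Walk (InR R) w (c i) d)
                  × (∀ i k → Walk (InR R) w (c i) k → d ≤ k)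

  -- orientation σ : edge e is oriented from tail to head
  tail : (Fin m → Bool) → Fin m → Fin n
  tail σ e = if σ e then proj₁ (ends e) else proj₂ (ends e)

  UniqueSink : (Fin m → Bool) → Fin n → Set
  UniqueSink σ v = (∀ e → tail σ e ≢ v) × (∀ x → x ≢ v → ∃[ e ] tail σ e ≡ x)

  TwoOut : (Fin m → Bool) → (Fin m → Set) → Fin n → Set
  TwoOut σ P u = ∃[ e₁ ] ∃[ e₂ ] (e₁ ≢ e₂ × P e₁ × P e₂ × tail σ e₁ ≡ u × tail σ e₂ ≡ u)

countTrue : ∀ {m} → (Fin m → Bool) → ℕ
countTrue {zero} R = 0
countTrue {suc m} R = (if R zero then 1 else 0) + countTrue (λ i → R (suc i))

module Submission where

-- Take a shortest R-walk v = x₀, …, x_D from v to C. As v is a sink, the arc x₀x₁ leaves x₁;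
-- following the walk, the first arc x_j x_{j+1} that does not leave x_{j+1} makes x_j a vertex
-- with two out-arcs (distinct, since a shortest walk does not backtrack) and depth D - j < D.
-- Otherwise the last arc leaves x_D ∈ C, and x_{D-1} ∉ C. The same argument once around C shows that
-- every vertex of C has an out-arc in C unless some vertex of C has two (consecutive edges of C
-- differ as |C| ≥ 3); at x_D this gives the second out-arc, and for D = 0 the sink v = x₀ has no
-- out-arc at all, so C contains a vertex with two out-arcs in C.

open import Defs
open import Data.Nat using (ℕ; zero; suc; _+_; _≤_; _<_; _⊔_; z≤n; s≤s)
open import Data.Nat.Properties using (≤-refl; ≤-pred; m≤n⇒m≤1+n; ≤-trans; n≤1+n; 1+n≰n; ≮⇒≥; <⇒≢; n<1+n; +-comm; anyUpTo?)
open import Data.Nat.Induction using (<-rec)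
open import Data.Fin using (Fin; zero; suc; toℕ; inject₁; fromℕ)
open import Data.Fin.Properties using (_≟_; any?; toℕ-inject₁; toℕ-fromℕ)
open import Data.Fin.Induction using (<-weakInduction)
open import Data.Fin.Relation.Unary.Top using (view; ‵fromℕ; ‵inject₁; view-fromℕ; view-inject₁)
open import Data.Bool using (Bool; true; false)
import Data.Bool.Properties as Bool
open import Data.Product using (_×_; _,_; proj₁; proj₂; ∃-syntax)
open import Data.Product.Properties using (≡-dec)
open import Data.Sum using (_⊎_; inj₁; inj₂)
open import Data.Empty using (⊥-elim)
open import Relation.Nullary using (¬_; Dec; yes; no)
open import Relation.Nullary.Decidable using (map′; _×-dec_; _⊎-dec_)
open import Relation.Binary.PropositionalEquality

least : ∀ {p} {P : ℕ → Set p} → (∀ j → Dec (P j)) → ∀ {n} → P n → ∃[ d ] (P d × (∀ j → P j → d ≤ j))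
least {p} {P} P? {n} = <-rec (λ n → P n → Least) search n
  where
  Least : Set p
  Least = ∃[ d ] (P d × (∀ j → P j → d ≤ j))
  search : ∀ n → (∀ {j} → j < n → P j → Least) → P n → Least
  search n below Pn with anyUpTo? P? n
  ... | yes (j , j<n , Pj) = below j<n Pj
  ... | no none = n , Pn , λ j Pj → ≮⇒≥ (λ j<n → none (j , j<n , Pj))

cyclicSuc : ∀ {k} → Fin (suc k) → Fin (suc k)
cyclicSuc i with view i
... | ‵fromℕ     = zero
... | ‵inject₁ j = suc j

cyclicSuc-fromℕ : ∀ k → cyclicSuc (fromℕ k) ≡ zero
cyclicSuc-fromℕ k rewrite view-fromℕ k = refl

cyclicSuc-inject₁ : ∀ {k} (j : Fin k) → cyclicSuc (inject₁ j) ≡ suc j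
cyclicSuc-inject₁ j rewrite view-inject₁ j = refl

cyclicSuc²≢id : ∀ {k} → 2 ≤ k → (i : Fin (suc k)) → cyclicSuc (cyclicSuc i) ≢ i
cyclicSuc²≢id (s≤s (s≤s _)) i with view i
... | ‵fromℕ = λ ()
... | ‵inject₁ j with view j
...   | ‵fromℕ = zero≢
  where zero≢ : ∀ {k} → zero ≢ inject₁ (fromℕ (suc k))
        zero≢ ()
...   | ‵inject₁ j′ = λ eq → <⇒≢ (m≤n⇒m≤1+n (n<1+n t)) (sym (toℕ-eq eq))
  where t : ℕ
        t = toℕ j′
        toℕ-eq : suc (suc j′) ≡ inject₁ (inject₁ j′) → suc (suc t) ≡ t
        toℕ-eq eq = begin
          suc (suc t)                   ≡⟨ cong toℕ eq ⟩
          toℕ (inject₁ (inject₁ j′))    ≡⟨ toℕ-inject₁ (inject₁ j′) ⟩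
          toℕ (inject₁ j′)              ≡⟨ toℕ-inject₁ j′ ⟩
          t                             ∎
          where open ≡-Reasoning

residue : ∀ {k} → ℕ → Fin (suc k)
residue zero    = zero
residue (suc j) = cyclicSuc (residue j)

residue-toℕ : ∀ {k} (i : Fin (suc k)) → residue (toℕ i) ≡ i
residue-toℕ = <-weakInduction (λ i → residue (toℕ i) ≡ i) refl residue-suc
  where
  residue-suc : ∀ {k} (i : Fin k) → residue (toℕ (inject₁ i)) ≡ inject₁ i → residue (suc (toℕ i)) ≡ suc i
  residue-suc {k} i residue-i = trans (cong cyclicSuc (trans (cong (residue {k}) (sym (toℕ-inject₁ i))) residue-i)) (cyclicSuc-inject₁ i)

residue-periodic : ∀ {k} j → residue {k} (j + suc k) ≡ residue j
residue-periodic {k} zero = begin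
  cyclicSuc (residue k)               ≡⟨ cong (λ j → cyclicSuc (residue j)) (sym (toℕ-fromℕ k)) ⟩
  cyclicSuc (residue (toℕ (fromℕ k))) ≡⟨ cong cyclicSuc (residue-toℕ (fromℕ k)) ⟩
  cyclicSuc (fromℕ k)             ≡⟨ cyclicSuc-fromℕ k ⟩
  zero                       ∎
  where open ≡-Reasoning
residue-periodic (suc j) = cong cyclicSuc (residue-periodic j)

module _ {n m : ℕ} (ends : Ends n m) where

  Joins-sym : ∀ {e x y} → Joins ends e x y → Joins ends e y x
  Joins-sym (inj₁ p) = inj₂ p
  Joins-sym (inj₂ p) = inj₁ p

  Joins-functional : ∀ {e x y y′} → Joins ends e x y → Joins ends e x y′ → y ≡ y′
  Joins-functional (inj₁ p) (inj₁ q) = cong proj₂ (trans (sym p) q)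
  Joins-functional (inj₁ p) (inj₂ q) = trans (cong proj₂ (trans (sym p) q)) (cong proj₁ (trans (sym p) q))
  Joins-functional (inj₂ p) (inj₁ q) = trans (cong proj₁ (trans (sym p) q)) (cong proj₂ (trans (sym p) q))
  Joins-functional (inj₂ p) (inj₂ q) = cong proj₁ (trans (sym p) q)

  Joins-endpoint : ∀ {e x y a b} → Joins ends e x y → Joins ends e a b → a ≡ x ⊎ a ≡ y
  Joins-endpoint (inj₁ p) (inj₁ q) = inj₁ (cong proj₁ (trans (sym q) p))
  Joins-endpoint (inj₁ p) (inj₂ q) = inj₂ (cong proj₂ (trans (sym q) p))
  Joins-endpoint (inj₂ p) (inj₁ q) = inj₂ (cong proj₁ (trans (sym q) p))
  Joins-endpoint (inj₂ p) (inj₂ q) = inj₁ (cong proj₂ (trans (sym q) p))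

  Joins? : ∀ e x y → Dec (Joins ends e x y)
  Joins? e x y = ≡-dec _≟_ _≟_ (ends e) (x , y) ⊎-dec ≡-dec _≟_ _≟_ (ends e) (y , x)

  edges-≢ : ∀ {e₁ e₂ a u b} → Joins ends e₁ a u → Joins ends e₂ u b → a ≢ b → e₁ ≢ e₂
  edges-≢ j₁ j₂ a≢b refl = a≢b (Joins-functional (Joins-sym j₁) j₂)

  Walk-to? : ∀ {P} → (∀ e → Dec (P e)) → ∀ {l} (c : Fin l → Fin n) j x → Dec (∃[ i ] Walk ends P x (c i) j)
  Walk-to? P? c zero x = map′ (λ (i , x≡cᵢ) → i , subst (λ z → Walk ends _ x z 0) x≡cᵢ nil)
                              (λ { (i , nil) → i , refl })
                              (any? (λ i → x ≟ c i))
  Walk-to? P? c (suc j) x = map′ (λ (e , y , p , x─y , i , w) → i , step e p x─y w)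
                                 (λ { (i , step e p x─y w) → e , _ , p , x─y , i , w })
                                 (any? λ e → any? λ y → P? e ×-dec Joins? e x y ×-dec Walk-to? P? c j y)

  module _ (σ : Fin m → Bool) where

    tail-Joins : ∀ {e x y} → Joins ends e x y → tail ends σ e ≡ x ⊎ tail ends σ e ≡ y
    tail-Joins {e} x─y with σ e | x─y
    ... | true  | inj₁ refl = inj₁ refl
    ... | true  | inj₂ refl = inj₂ refl
    ... | false | inj₁ refl = inj₂ refl
    ... | false | inj₂ refl = inj₁ refl

    TwoOut-mono : ∀ {P Q : Fin m → Set} {u} → (∀ e → P e → Q e) → TwoOut ends σ P u → TwoOut ends σ Q u
    TwoOut-mono P⇒Q (e₁ , e₂ , e₁≢e₂ , p₁ , p₂ , t₁ , t₂) = e₁ , e₂ , e₁≢e₂ , P⇒Q e₁ p₁ , P⇒Q e₂ p₂ , t₁ , t₂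

    peak⇒TwoOut : ∀ {P : Fin m → Set} {e₁ e₂ a u b} → P e₁ → P e₂ → Joins ends e₁ a u → Joins ends e₂ u b
                → a ≢ b → tail ends σ e₁ ≡ u → tail ends σ e₂ ≡ u → TwoOut ends σ P u
    peak⇒TwoOut p₁ p₂ a─u u─b a≢b t₁ t₂ = _ , _ , edges-≢ a─u u─b a≢b , p₁ , p₂ , t₁ , t₂

    -- A discrete intermediate value theorem: backward arcs persist along a walk until a peak.
    module Climb (x : ℕ → Fin n) (E : ℕ → Fin m) (x─x : ∀ j → Joins ends (E j) (x j) (x (suc j))) where

      PointsBack : ℕ → Set
      PointsBack j = tail ends σ (E j) ≡ x (suc j)

      Peak : ℕ → Set
      Peak j = PointsBack j × tail ends σ (E (suc j)) ≡ x (suc j)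

      climb : ∀ {a} l → PointsBack a → (∃[ j ] Peak j) ⊎ PointsBack (l + a)
      climb zero back = inj₂ back
      climb (suc l) back with climb l back
      ... | inj₁ peak = inj₁ peak
      ... | inj₂ back′ with tail-Joins (x─x (suc (l + _)))
      ...   | inj₁ t = inj₁ (l + _ , back′ , t)
      ...   | inj₂ t = inj₂ t

module _ {n m : ℕ} (ends : Ends n m) {k : ℕ} (c : Fin (suc k) → Fin n) where

  Consec-cyclicSuc : ∀ i → Consec ends c (c i) (c (cyclicSuc i))
  Consec-cyclicSuc i with view i
  ... | ‵fromℕ     = inj₂ (refl , refl)
  ... | ‵inject₁ j = inj₁ (j , refl , refl)

  Consec-OnCycle : ∀ {x y} → Consec ends c x y → OnCycle ends c x × OnCycle ends c y
  Consec-OnCycle (inj₁ (i , x≡ , y≡)) = (inject₁ i , x≡) , (suc i , y≡)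
  Consec-OnCycle (inj₂ (x≡ , y≡))     = (fromℕ k , x≡) , (zero , y≡)

  CEdge-OnCycle : ∀ {e a b} → CEdge ends c e → Joins ends e a b → OnCycle ends c a
  CEdge-OnCycle (x , y , x→y , x─y) a─b with Joins-endpoint ends x─y a─b
  ... | inj₁ refl = proj₁ (Consec-OnCycle x→y)
  ... | inj₂ refl = proj₂ (Consec-OnCycle x→y)

  module _ (cyc : IsCycle ends c) (σ : Fin m → Bool) where

    around : ℕ → Fin n
    around j = c (residue j)

    aroundEdge : ℕ → Fin m
    aroundEdge j = proj₁ (proj₂ (proj₂ cyc) _ _ (Consec-cyclicSuc (residue j)))

    aroundEdge-Joins : ∀ j → Joins ends (aroundEdge j) (around j) (around (suc j))
    aroundEdge-Joins j = proj₂ (proj₂ (proj₂ cyc) _ _ (Consec-cyclicSuc (residue j)))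

    aroundEdge-CEdge : ∀ j → CEdge ends c (aroundEdge j)
    aroundEdge-CEdge j = _ , _ , Consec-cyclicSuc (residue j) , aroundEdge-Joins j

    around-≢ : ∀ j → around j ≢ around (suc (suc j))
    around-≢ j eq = cyclicSuc²≢id (proj₁ cyc) (residue j) (sym (proj₁ (proj₂ cyc) _ _ eq))

    open Climb ends σ around aroundEdge aroundEdge-Joins

    OutArc⊎TwoOut : ∀ i → (∃[ e ] (CEdge ends c e × tail ends σ e ≡ c i)) ⊎ (∃[ i′ ] TwoOut ends σ (CEdge ends c) (c i′))
    OutArc⊎TwoOut i with tail-Joins ends σ (aroundEdge-Joins (toℕ i))
    ... | inj₁ t = inj₁ (_ , aroundEdge-CEdge (toℕ i) , trans t (cong c (residue-toℕ i)))
    ... | inj₂ back with climb k back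
    ...   | inj₁ (j , b₁ , b₂) = inj₂ (_ , peak⇒TwoOut ends σ (aroundEdge-CEdge j) (aroundEdge-CEdge (suc j))
                                          (aroundEdge-Joins j) (aroundEdge-Joins (suc j)) (around-≢ j) b₁ b₂)
    ...   | inj₂ back′ = inj₁ (_ , aroundEdge-CEdge (k + toℕ i) , trans back′ closes)
      where closes : around (suc k + toℕ i) ≡ c i
            closes = cong c (begin
              residue (suc k + toℕ i) ≡⟨ cong residue (+-comm (suc k) (toℕ i)) ⟩
              residue (toℕ i + suc k) ≡⟨ residue-periodic (toℕ i) ⟩
              residue (toℕ i)         ≡⟨ residue-toℕ i ⟩
              i                       ∎)
              where open ≡-Reasoning

module _ {n m : ℕ} (ends : Ends n m) {k : ℕ} (c : Fin (suc k) → Fin n) (R : Fin m → Bool) where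

  DepthAtLeast : Fin n → ℕ → Set
  DepthAtLeast x d = ∀ i l → Walk ends (InR ends R) x (c i) l → d ≤ l

  DepthAtLeast-step : ∀ {e x y d} → InR ends R e → Joins ends e x y → DepthAtLeast x (suc d) → DepthAtLeast y d
  DepthAtLeast-step r x─y deep i l w = ≤-pred (deep i (suc l) (step _ r x─y w))

  depth-exists : Connected ends (InR ends R) → ∀ x → ∃[ d ] IsDepth ends c R x d
  depth-exists connected x with least (λ j → Walk-to? ends (λ e → R e Bool.≟ true) c j x) (zero , proj₂ (connected x (c zero)))
  ... | d , reach , minimal = d , reach , λ i l w → minimal l (i , w)

  OnCycle-depth : ∀ i → IsDepth ends c R (c i) 0
  OnCycle-depth i = (i , nil) , λ _ _ _ → z≤n

  module _ (σ : Fin m → Bool) where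

    climbToCycle : ∀ {e x y d i} → InR ends R e → Joins ends e x y → tail ends σ e ≡ y
            → Walk ends (InR ends R) y (c i) d → DepthAtLeast x (suc d)
            → (∃[ u ] ∃[ du ] (IsDepth ends c R u du × du ≤ d × TwoOut ends σ (InR ends R) u))
            ⊎ (∃[ e′ ] (InR ends R e′ × ¬ CEdge ends c e′ × tail ends σ e′ ≡ c i))
    climbToCycle r x─y t nil deep = inj₂ (_ , r , off-cycle , t)
      where off-cycle : ¬ CEdge ends c _
            off-cycle e∈C with CEdge-OnCycle ends c e∈C x─y
            ... | i , refl with () ← deep i 0 nil
    climbToCycle r x─y t w@(step e′ r′ y─z w′) deep with tail-Joins ends σ y─z
    ... | inj₁ t′ = inj₁ (_ , _ , ((_ , w) , DepthAtLeast-step r x─y deep) , ≤-refl ,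
                          peak⇒TwoOut ends σ r r′ x─y y─z x≢z t t′)
      where x≢z : _ ≢ _
            x≢z refl = 1+n≰n (≤-trans (n≤1+n _) (deep _ _ w′))
    ... | inj₂ t′ with climbToCycle r′ y─z t′ w′ (DepthAtLeast-step r x─y deep)
    ...   | inj₁ (u , du , u-depth , du≤d , two) = inj₁ (u , du , u-depth , m≤n⇒m≤1+n du≤d , two)
    ...   | inj₂ arc = inj₂ arc

module _ {n m : ℕ} (ends : Ends n m) {k : ℕ} (c : Fin (suc k) → Fin n) (cyc : IsCycle ends c)
         (R : Fin m → Bool) (C⊆R : ∀ e → CEdge ends c e → InR ends R e) (σ : Fin m → Bool) where

  offCycleArc⇒TwoOut : ∀ {e i} → InR ends R e → ¬ CEdge ends c e → tail ends σ e ≡ c i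
                     → ∃[ i′ ] TwoOut ends σ (InR ends R) (c i′)
  offCycleArc⇒TwoOut {e} {i} r e∉C t with OutArc⊎TwoOut ends c cyc σ i
  ... | inj₁ (e′ , e′∈C , t′) = i , e , e′ , (λ { refl → e∉C e′∈C }) , r , C⊆R e′ e′∈C , t , t′
  ... | inj₂ (i′ , two)       = i′ , TwoOut-mono ends σ C⊆R two

lemma5p1 : ∀ {n m : ℕ} (ends : Ends n m) → IsSimple ends → Connected ends (AllE ends)
    → ∀ {k} (c : Fin (suc k) → Fin n) → IsCycle ends c
    → (R : Fin m → Bool) → (∀ e → CEdge ends c e → InR ends R e)
    → Connected ends (InR ends R) → countTrue R ≡ n
    → (σ : Fin m → Bool) (v : Fin n) → UniqueSink ends σ v
    → ∃[ u ] ∃[ du ] ∃[ dv ] (IsDepth ends c R u du × IsDepth ends c R v dv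
        × TwoOut ends σ (InR ends R) u × du < 1 ⊔ dv
        × (du ≡ 0 → dv ≡ 0 → TwoOut ends σ (CEdge ends c) u))
lemma5p1 ends _ _ c cyc R C⊆R connected _ σ v (sink , _) with depth-exists ends c R connected v
... | zero , v-depth@((i , nil) , _) with OutArc⊎TwoOut ends c cyc σ i
...   | inj₁ (e , _ , t)  = ⊥-elim (sink e t)
...   | inj₂ (i′ , two) = c i′ , 0 , 0 , OnCycle-depth ends c R i′ , v-depth , TwoOut-mono ends σ C⊆R two , s≤s z≤n , λ _ _ → two
lemma5p1 ends _ _ c cyc R C⊆R connected _ σ v (sink , _)
    | suc d , v-depth@((i , step e r v─y w) , deep) with tail-Joins ends σ v─y
... | inj₁ t = ⊥-elim (sink e t)
... | inj₂ t with climbToCycle ends c R σ r v─y t w deep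
...   | inj₁ (u , du , u-depth , du≤d , two) = u , du , suc d , u-depth , v-depth , two , s≤s du≤d , λ _ ()
...   | inj₂ (e′ , r′ , e′∉C , t′) with offCycleArc⇒TwoOut ends c cyc R C⊆R σ r′ e′∉C t′
...     | i′ , two = c i′ , 0 , suc d , OnCycle-depth ends c R i′ , v-depth , two , s≤s z≤n , λ _ ()
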